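{- Let $m$ and $M$ be two positive integers. If $\rho (m,M)=2$, then $\mathsf{D}(\llbracket -m,M \rrbracket ) = m+M-2$.
   Context: A finite sequence of integers is an unordered finite multiset of integers; its length is its number of elements counted with multiplicity. $S=s_1\cdots s_n$ is a zero-sum sequence if $\sum s_i=0$, and minimal if moreover no non-empty proper subsequence sums to $0$. For integers $a\le b$, $\llbracket a,b\rrbracket$ is the set of integers between $a$ and $b$. $\mathsf{D}(\llbracket -m,M\rrbracket)$ is the maximal length of a minimal zero-sum sequence with all elements in $\llbracket -m,M\rrbracket$. Define $\rho(m,M)=\min\{t\in\mathbb{Z}_{\ge 0} : \exists\, t'\in\mathbb{Z},\ 0\le t'\le t,\ \gcd(M-t',\,m-(t-t'))=1\}$. -}

module Defs where

open import Data.Nat as ℕ using (ℕ; suc)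
open import Data.Integer as ℤ using (ℤ; +_; -_)
open import Data.Integer.GCD using (gcd)
open import Data.List using (List; []; _∷_; length; foldr)
open import Data.List.Relation.Unary.All using (All)
open import Data.List.Relation.Binary.Sublist.Propositional using (_⊆_)
open import Data.Product using (Σ; ∃; _×_; _,_)
open import Relation.Binary.PropositionalEquality using (_≡_; _≢_)
open import Relation.Nullary using (¬_)

-- A finite sequence of integers (a multiset) is represented by a list;
-- only the multiset of entries matters for the notions below.
-- A subsequence of S is a sublist of S (every sub-multiset of S arises
-- as a sublist of S).

InInterval : ℤ → ℤ → ℤ → Set
InInterval a b x = a ℤ.≤ x × x ℤ.≤ b

IsZeroSum : List ℤ → Set
IsZeroSum S = foldr ℤ._+_ ℤ.0ℤ S ≡ ℤ.0ℤ

IsMinimalZeroSum : List ℤ → Set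
IsMinimalZeroSum S =
  (0 ℕ.< length S) × IsZeroSum S ×
  (∀ (T : List ℤ) → T ⊆ S → 0 ℕ.< length T → length T ℕ.< length S →
     ¬ IsZeroSum T)

IsMZSOver : ℕ → ℕ → List ℤ → Set
IsMZSOver m M S = All (InInterval (- (+ m)) (+ M)) S × IsMinimalZeroSum S

DIntervalIs : ℕ → ℕ → ℕ → Set
DIntervalIs m M d =
  (Σ (List ℤ) λ S → IsMZSOver m M S × length S ≡ d) ×
  (∀ S → IsMZSOver m M S → length S ℕ.≤ d)

RhoCond : ℕ → ℕ → ℕ → Set
RhoCond m M t =
  ∃ λ (t' : ℕ) → t' ℕ.≤ t ×
    gcd (+ M ℤ.- + t') (+ m ℤ.- (+ t ℤ.- + t')) ≡ ℤ.1ℤ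

RhoIs : ℕ → ℕ → ℕ → Set
RhoIs m M r = RhoCond m M r × (∀ t → t ℕ.< r → ¬ RhoCond m M t)

-- Lower bound: if gcd (M - t′) (m - (2 - t′)) = 1, then b copies of a = M - t′ together with
-- a copies of -b, where b = m - (2 - t′), form a minimal zero-sum sequence of length m + M - 2.
--
-- Upper bound: a zero-sum sequence of nonzero terms can be ordered greedily, taking a positive
-- term whenever the partial sum is negative and a negative term otherwise. For a minimal
-- sequence the partial sums are pairwise distinct (a repetition would cut out a proper zero-sum
-- block) and lie in [-m, M), so there are at most m positive and at most M negative terms, and
-- a sequence of length m + M - 1 has, up to negation, exactly m positive terms. Then every
-- negative term is -m: a walk starting with a negative term x > -m would confine the m partial
-- sums preceding positive terms to [-m + 1, -1]. Now no proper subsequence of the m positive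
-- terms sums to 0 modulo m, which makes each of them coprime to m; as ρ = 2 makes M and M - 1
-- non-coprime to m, they are all at most M - 2, and their sum (#negatives) · m ≥ (M - 1) · m
-- exceeds m · (M - 2).
--
-- Coprimality: let x be one positive term and T₀, …, T_{m-1} the prefix sums of the others.
-- Their residues modulo m are distinct, hence exhaust ℤ/m, and T_i ≡ x + T_j forces j < i when
-- i > 0; by induction every T_i, in particular the one ≡ 1, is a multiple of x modulo m.

module Submission where

open import Defs

open import Data.Empty using (⊥-elim)
open import Data.Integer as ℤ using (ℤ; +_; -_; 0ℤ)
import Data.Integer.GCD as ℤGCD
import Data.Integer.Properties as ℤP
open import Data.List
  using (List; []; _∷_; length; foldr; _++_; replicate; map; filter; take; applyUpTo; upTo)
import Data.List.Properties as LP
open import Data.List.Membership.Propositional using (_∈_; find)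
import Data.List.Membership.Propositional.Properties as MP
open import Data.List.Relation.Binary.Permutation.Propositional
  using (_↭_; refl; prep; swap; trans; ↭-sym; ↭-trans; ↭⇒↭ₛ)
import Data.List.Relation.Binary.Permutation.Propositional.Properties as PermP
open import Data.List.Relation.Binary.Permutation.Setoid.Properties using (foldr-commMonoid)
open import Data.List.Relation.Binary.Sublist.Propositional using (_⊆_; []; _∷_; _∷ʳ_; minimum; from∈)
import Data.List.Relation.Binary.Sublist.Propositional.Properties as SublistP
open import Data.List.Relation.Unary.All as All using (All; []; _∷_)
import Data.List.Relation.Unary.All.Properties as AllP
open import Data.List.Relation.Unary.AllPairs as AllPairs using (AllPairs; []; _∷_)
import Data.List.Relation.Unary.AllPairs.Properties as AllPairsP
open import Data.List.Relation.Unary.Any using (Any; here; there)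
open import Data.Nat as ℕ using (ℕ; zero; suc; _<_; _≤_; _+_; _∸_; _*_; _%_; _/_; z≤n; s≤s)
open import Data.Nat.Coprimality as Coprimality using (Coprime)
open import Data.Nat.DivMod using (m≡m%n+[m/n]*n; m%n<n)
open import Data.Nat.Divisibility
  using (_∣_; divides; _∣0; ∣⇒≤; n∣m*n; ∣m∣n⇒∣m+n; ∣m+n∣m⇒∣n; ∣n∣m%n⇒∣m; %-presˡ-∣; ∣1⇒≡1)
import Data.Nat.GCD as ℕGCD
open import Data.Nat.Induction using (<-rec)
open import Data.Nat.ListAction using (sum)
open import Data.Nat.ListAction.Properties using (sum-↭)
import Data.Nat.Properties as ℕP
open import Data.List.Membership.DecPropositional ℕP._≟_ using (_∈?_)
open import Data.Product using (Σ; ∃; ∃₂; _×_; _,_; proj₁; proj₂)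
open import Data.Sum using (_⊎_; inj₁; inj₂; [_,_]′)
open import Function using (_∘_)
open import Relation.Binary.PropositionalEquality as ≡
  using (_≡_; _≢_; refl; sym; cong; cong₂; subst; subst₂)
open import Relation.Nullary using (¬_; yes; no)

open import Algebra.Properties.AbelianGroup ℤP.+-0-abelianGroup using (identityʳ-unique)
open import Algebra.Properties.CommutativeSemigroup ℕP.+-commutativeSemigroup using (x∙yz≈y∙xz)

⊆-↭-exchange : ∀ {A : Set} {T U V : List A} → T ⊆ U → U ↭ V → ∃ λ T′ → T′ ⊆ V × T′ ↭ T
⊆-↭-exchange τ refl = _ , τ , refl
⊆-↭-exchange (x ∷ʳ τ) (prep x p) with T′ , σ , π ← ⊆-↭-exchange τ p = T′ , x ∷ʳ σ , π
⊆-↭-exchange (refl ∷ τ) (prep x p) with T′ , σ , π ← ⊆-↭-exchange τ p = x ∷ T′ , refl ∷ σ , prep x π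
⊆-↭-exchange (x ∷ʳ (y ∷ʳ τ)) (swap x y p) with T′ , σ , π ← ⊆-↭-exchange τ p =
  T′ , y ∷ʳ (x ∷ʳ σ) , π
⊆-↭-exchange (x ∷ʳ (refl ∷ τ)) (swap x y p) with T′ , σ , π ← ⊆-↭-exchange τ p =
  y ∷ T′ , refl ∷ (x ∷ʳ σ) , prep y π
⊆-↭-exchange (refl ∷ (y ∷ʳ τ)) (swap x y p) with T′ , σ , π ← ⊆-↭-exchange τ p =
  x ∷ T′ , y ∷ʳ (refl ∷ σ) , prep x π
⊆-↭-exchange (refl ∷ (refl ∷ τ)) (swap x y p) with T′ , σ , π ← ⊆-↭-exchange τ p =
  y ∷ x ∷ T′ , refl ∷ (refl ∷ σ) , swap y x π
⊆-↭-exchange τ (trans p q)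
  with T₁ , σ₁ , π₁ ← ⊆-↭-exchange τ p
  with T₂ , σ₂ , π₂ ← ⊆-↭-exchange σ₁ q = T₂ , σ₂ , ↭-trans π₂ π₁

∈⇒↭∷ : ∀ {A : Set} {x : A} {xs} → x ∈ xs → ∃ λ ys → xs ↭ x ∷ ys
∈⇒↭∷ x∈xs with h , t , refl ← MP.∈-∃++ x∈xs = h ++ t , PermP.shift _ h t

all≡⇒replicate : ∀ {A : Set} {z : A} xs → All (_≡ z) xs → xs ≡ replicate (length xs) z
all≡⇒replicate []       []          = refl
all≡⇒replicate (x ∷ xs) (refl ∷ eq) = cong (x ∷_) (all≡⇒replicate xs eq)

⊆-replicate-++ : ∀ {A : Set} {T : List A} k x ys → T ⊆ replicate k x ++ ys →
  ∃₂ λ i T′ → i ≤ k × T′ ⊆ ys × T ≡ replicate i x ++ T′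
⊆-replicate-++ zero    x ys τ = 0 , _ , z≤n , τ , refl
⊆-replicate-++ (suc k) x ys (.x ∷ʳ τ) with i , T′ , i≤k , σ , eq ← ⊆-replicate-++ k x ys τ =
  i , T′ , ℕP.m≤n⇒m≤1+n i≤k , σ , eq
⊆-replicate-++ (suc k) x ys (refl ∷ τ) with i , T′ , i≤k , σ , eq ← ⊆-replicate-++ k x ys τ =
  suc i , T′ , s≤s i≤k , σ , cong (x ∷_) eq

⊆-replicate : ∀ {A : Set} {T : List A} {k x} → T ⊆ replicate k x → ∃ λ j → T ≡ replicate j x
⊆-replicate {T = T} {k} τ = length T , all≡⇒replicate T (SublistP.All-resp-⊆ τ (AllP.replicate⁺ k refl))

replicate-⊆ : ∀ {A : Set} {j q} (z : A) → j ≤ q → replicate j z ⊆ replicate q z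
replicate-⊆ {q = q} z z≤n       = minimum (replicate q z)
replicate-⊆         z (s≤s j≤q) = refl ∷ replicate-⊆ z j≤q

distinct-⊆-length≤ : ∀ {A : Set} {xs ys : List A} → AllPairs _≢_ xs → (∀ {v} → v ∈ xs → v ∈ ys) →
  length xs ≤ length ys
distinct-⊆-length≤ [] _ = z≤n
distinct-⊆-length≤ {xs = x ∷ xs} (x∉xs ∷ xs!) xs⊆ys with ys′ , ys↭ ← ∈⇒↭∷ (xs⊆ys (here refl)) =
  subst (suc (length xs) ≤_) (sym (PermP.↭-length ys↭)) (s≤s (distinct-⊆-length≤ xs! xs⊆ys′))
  where
  xs⊆ys′ : ∀ {v} → v ∈ xs → v ∈ ys′
  xs⊆ys′ v∈xs with PermP.∈-resp-↭ ys↭ (xs⊆ys (there v∈xs))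
  ... | here refl = ⊥-elim (All.lookup x∉xs v∈xs refl)
  ... | there v∈ys′ = v∈ys′

injective⇒surjective : ∀ m (f : ℕ → ℕ) → (∀ {i j} → i < j → j < m → f i ≢ f j) → (∀ i → f i < m) →
  ∀ {r} → r < m → ∃ λ i → i < m × f i ≡ r
injective⇒surjective m f f-inj f<m {r} r<m with r ∈? applyUpTo f m
... | yes r∈image = let i , i<m , r≡fi = MP.∈-applyUpTo⁻ f r∈image in i , i<m , sym r≡fi
... | no  r∉image = ⊥-elim (ℕP.<-irrefl refl
  (subst₂ _≤_ (cong suc (LP.length-applyUpTo f m)) (LP.length-upTo m) (distinct-⊆-length≤ r∷image! r∷image⊆)))
  where
  r∷image! : AllPairs _≢_ (r ∷ applyUpTo f m)
  r∷image! = All.tabulate (λ v∈ r≡v → r∉image (subst (_∈ _) (sym r≡v) v∈)) ∷ AllPairsP.applyUpTo⁺₁ f m f-inj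
  r∷image⊆ : ∀ {v} → v ∈ r ∷ applyUpTo f m → v ∈ upTo m
  r∷image⊆ (here refl) = MP.∈-upTo⁺ r<m
  r∷image⊆ (there v∈) with i , _ , refl ← MP.∈-applyUpTo⁻ f v∈ = MP.∈-upTo⁺ (f<m i)

%-cancelˡ-+ : ∀ a b m .{{_ : ℕ.NonZero m}} → (a + b) % m ≡ a % m → m ∣ b
%-cancelˡ-+ a b m eq = ∣m+n∣m⇒∣n (divides ((a + b) / m) (ℕP.+-cancelˡ-≡ (a % m) _ _ split)) (n∣m*n (a / m))
  where
  open ≡.≡-Reasoning
  split : a % m + (a / m * m + b) ≡ a % m + (a + b) / m * m
  split = begin
    a % m + (a / m * m + b)       ≡⟨ ℕP.+-assoc (a % m) _ b ⟨
    a % m + a / m * m + b         ≡⟨ cong (_+ b) (m≡m%n+[m/n]*n a m) ⟨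
    a + b                         ≡⟨ m≡m%n+[m/n]*n (a + b) m ⟩
    (a + b) % m + (a + b) / m * m ≡⟨ cong (_+ (a + b) / m * m) eq ⟩
    a % m + (a + b) / m * m       ∎

coprime-equalMultiples : ∀ {a b i j} → Coprime a b → 0 < b → i ≤ b → i * a ≡ j * b →
  (i ≡ 0 × j ≡ 0) ⊎ (i ≡ b × j ≡ a)
coprime-equalMultiples {b = b@(suc _)} {zero} {j} _ _ _ eq = inj₁ (refl , ℕP.m*n≡0⇒m≡0 j b (sym eq))
coprime-equalMultiples {a} {b@(suc _)} {i@(suc _)} {j} cop _ i≤b eq = inj₂ (i≡b , j≡a)
  where
  b∣i : b ∣ i
  b∣i = Coprimality.coprime-divisor (Coprimality.sym cop) (divides j (≡.trans (ℕP.*-comm a i) eq))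
  i≡b : i ≡ b
  i≡b = ℕP.≤-antisym i≤b (∣⇒≤ b∣i)
  j≡a : j ≡ a
  j≡a = ℕP.*-cancelʳ-≡ j a b (≡.trans (sym eq) (≡.trans (cong (_* a) i≡b) (ℕP.*-comm b a)))

¬coprime⇒3≤ : ∀ {k n} → 0 < n → ¬ Coprime k n → ¬ Coprime k (n ∸ 1) → 3 ≤ n
¬coprime⇒3≤ {k} {suc zero}          _ k∤1 _   = ⊥-elim (k∤1 (Coprimality.sym (Coprimality.1-coprimeTo k)))
¬coprime⇒3≤ {k} {suc (suc zero)}    _ _   k∤1 = ⊥-elim (k∤1 (Coprimality.sym (Coprimality.1-coprimeTo k)))
¬coprime⇒3≤ {k} {suc (suc (suc _))} _ _   _   = s≤s (s≤s (s≤s z≤n))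

[m∸[t∸t′]]+[M∸t′]≡m+M∸t : ∀ {m M t t′} → t′ ≤ t → t ∸ t′ ≤ m → t′ ≤ M →
  (m ∸ (t ∸ t′)) + (M ∸ t′) ≡ m + M ∸ t
[m∸[t∸t′]]+[M∸t′]≡m+M∸t {m} {M} {t} {t′} t′≤t u≤m t′≤M = begin
  (m ∸ u) + (M ∸ t′)  ≡⟨ ℕP.+-∸-assoc (m ∸ u) t′≤M ⟨
  (m ∸ u) + M ∸ t′    ≡⟨ cong (_∸ t′) (ℕP.+-∸-comm M u≤m) ⟨
  m + M ∸ u ∸ t′      ≡⟨ ℕP.∸-+-assoc (m + M) u t′ ⟩
  m + M ∸ (u + t′)    ≡⟨ cong (m + M ∸_) (ℕP.m∸n+n≡m t′≤t) ⟩
  m + M ∸ t           ∎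
  where
  open ≡.≡-Reasoning
  u = t ∸ t′

sum-⊆ : ∀ {T P} → T ⊆ P → sum T ≤ sum P
sum-⊆ []         = z≤n
sum-⊆ (y ∷ʳ τ)   = ℕP.≤-trans (sum-⊆ τ) (ℕP.m≤n+m _ y)
sum-⊆ (refl ∷ τ) = ℕP.+-monoʳ-≤ _ (sum-⊆ τ)

sum≤length* : ∀ {c} P → All (_≤ c) P → sum P ≤ length P * c
sum≤length* []      []           = z≤n
sum≤length* (y ∷ P) (y≤c ∷ P≤c) = ℕP.+-mono-≤ y≤c (sum≤length* P P≤c)

take-segment : ∀ {i j} (A : List ℕ) → i ≤ j → j ≤ length A →
  ∃ λ s → s ⊆ A × length s ≡ j ∸ i × sum (take j A) ≡ sum (take i A) + sum s
take-segment {zero} {j} A _ j≤∣A∣ =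
  take j A , SublistP.take-⊆ j A , ≡.trans (LP.length-take j A) (ℕP.m≤n⇒m⊓n≡m j≤∣A∣) , refl
take-segment {suc i} {suc j} (a ∷ A) (s≤s i≤j) (s≤s j≤∣A∣)
  with s , τ , ∣s∣ , eq ← take-segment A i≤j j≤∣A∣ =
  s , a ∷ʳ τ , ∣s∣ , ≡.trans (cong (λ t → a + t) eq) (sym (ℕP.+-assoc a _ _))

sumℤ : List ℤ → ℤ
sumℤ = foldr ℤ._+_ 0ℤ

sumℤ-++ : ∀ xs ys → sumℤ (xs ++ ys) ≡ sumℤ xs ℤ.+ sumℤ ys
sumℤ-++ []       ys = sym (ℤP.+-identityˡ _)
sumℤ-++ (x ∷ xs) ys = ≡.trans (cong (λ w → x ℤ.+ w) (sumℤ-++ xs ys)) (sym (ℤP.+-assoc x _ _))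

sumℤ-↭ : ∀ {xs ys} → xs ↭ ys → sumℤ xs ≡ sumℤ ys
sumℤ-↭ p = foldr-commMonoid (≡.setoid ℤ) ℤP.+-0-isCommutativeMonoid (↭⇒↭ₛ p)

sumℤ-replicate : ∀ k z → sumℤ (replicate k z) ≡ + k ℤ.* z
sumℤ-replicate zero    z = sym (ℤP.*-zeroˡ z)
sumℤ-replicate (suc k) z = ≡.trans (cong (λ w → z ℤ.+ w) (sumℤ-replicate k z)) (sym (ℤP.suc-* (+ k) z))

sumℤ-replicate-pos : ∀ i a → sumℤ (replicate i (+ a)) ≡ + (i * a)
sumℤ-replicate-pos i a = ≡.trans (sumℤ-replicate i (+ a)) (sym (ℤP.pos-* i a))

sumℤ-replicate-neg : ∀ j b → sumℤ (replicate j (- + b)) ≡ - + (j * b)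
sumℤ-replicate-neg j b = ≡.trans (sumℤ-replicate j (- + b))
  (≡.trans (sym (ℤP.neg-distribʳ-* (+ j) (+ b))) (cong -_ (sym (ℤP.pos-* j b))))

sumℤ-map-+ : ∀ P → sumℤ (map +_ P) ≡ + sum P
sumℤ-map-+ []      = refl
sumℤ-map-+ (y ∷ P) = cong (λ w → + y ℤ.+ w) (sumℤ-map-+ P)

sumℤ-map-neg : ∀ S → sumℤ (map -_ S) ≡ - sumℤ S
sumℤ-map-neg []       = refl
sumℤ-map-neg (x ∷ xs) =
  ≡.trans (cong (λ w → - x ℤ.+ w) (sumℤ-map-neg xs)) (sym (ℤP.neg-distrib-+ x (sumℤ xs)))

zeroSum-++⇒ : ∀ xs ys {u v} → sumℤ xs ≡ + u → sumℤ ys ≡ - + v → IsZeroSum (xs ++ ys) → u ≡ v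
zeroSum-++⇒ xs ys {u} {v} Σxs Σys z = ℤP.+-injective (ℤP.i-j≡0⇒i≡j (+ u) (+ v) (begin
  + u ℤ.- + v          ≡⟨ cong₂ ℤ._+_ Σxs Σys ⟨
  sumℤ xs ℤ.+ sumℤ ys  ≡⟨ sumℤ-++ xs ys ⟨
  sumℤ (xs ++ ys)      ≡⟨ z ⟩
  0ℤ                   ∎))
  where open ≡.≡-Reasoning

-- Minimal zero-sum sequences

NoProperZeroSubsum : List ℤ → Set
NoProperZeroSubsum S = ∀ T → T ⊆ S → 0 < length T → length T < length S → ¬ IsZeroSum T

NoProperZeroSubsum-↭ : ∀ {U V} → NoProperZeroSubsum U → U ↭ V → NoProperZeroSubsum V
NoProperZeroSubsum-↭ hU p T τ 0<∣T∣ ∣T∣<∣V∣ T≡0 with T′ , σ , π ← ⊆-↭-exchange τ (↭-sym p) =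
  hU T′ σ (subst (0 <_) (sym ∣π∣) 0<∣T∣) (subst₂ _<_ (sym ∣π∣) (sym (PermP.↭-length p)) ∣T∣<∣V∣)
    (≡.trans (sumℤ-↭ π) T≡0)
  where ∣π∣ = PermP.↭-length π

minimal⇒nonzero : ∀ {S} → IsMinimalZeroSum S → 2 ≤ length S → All (_≢ 0ℤ) S
minimal⇒nonzero (_ , _ , hS) 2≤∣S∣ = All.tabulate λ {v} v∈S v≡0 →
  hS (v ∷ []) (from∈ v∈S) (s≤s z≤n) 2≤∣S∣ (≡.trans (ℤP.+-identityʳ v) v≡0)

map-neg-involutive : ∀ S → map -_ (map -_ S) ≡ S
map-neg-involutive S =
  ≡.trans (sym (LP.map-∘ S)) (LP.map-id-local (All.tabulate (λ _ → ℤP.neg-involutive _)))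

MZSOver-map-neg : ∀ {m M S} → IsMZSOver m M S → IsMZSOver M m (map -_ S)
MZSOver-map-neg {m} {S = S} (S∈ , 0<∣S∣ , ΣS≡0 , hS) =
  AllP.map⁺ (All.map (λ (lo , hi) →
    ℤP.neg-mono-≤ hi , subst (_ ℤ.≤_) (ℤP.neg-involutive (+ m)) (ℤP.neg-mono-≤ lo)) S∈) ,
  subst (0 <_) (sym (LP.length-map -_ S)) 0<∣S∣ ,
  ≡.trans (sumℤ-map-neg S) (cong -_ ΣS≡0) ,
  λ T τ 0<∣T∣ ∣T∣< ΣT≡0 →
    hS (map -_ T) (subst (map -_ T ⊆_) (map-neg-involutive S) (SublistP.map⁺ -_ τ))
    (subst (0 <_) (sym (LP.length-map -_ T)) 0<∣T∣)
    (subst₂ _<_ (sym (LP.length-map -_ T)) (LP.length-map -_ S) ∣T∣<)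
    (≡.trans (sumℤ-map-neg T) (cong -_ ΣT≡0))

twoValued : ℕ → ℕ → ℕ → ℕ → List ℤ
twoValued i a j b = replicate i (+ a) ++ replicate j (- + b)

length-twoValued : ∀ i a j b → length (twoValued i a j b) ≡ i + j
length-twoValued i a j b =
  ≡.trans (LP.length-++ (replicate i _)) (cong₂ _+_ (LP.length-replicate i) (LP.length-replicate j))

twoValued-minimal : ∀ {a b} → Coprime a b → 0 < b → IsMinimalZeroSum (twoValued b a a b)
twoValued-minimal {a} {b} cop 0<b =
  subst (0 <_) (sym (length-twoValued b a a b)) (ℕP.<-≤-trans 0<b (ℕP.m≤m+n b a)) ,
  ≡.trans (sumℤ-++ (replicate b (+ a)) _)
    (≡.trans (cong₂ ℤ._+_ (≡.trans (sumℤ-replicate-pos b a) (cong +_ (ℕP.*-comm b a)))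
                          (sumℤ-replicate-neg a b))
      (ℤP.+-inverseʳ (+ (a * b)))) ,
  noProperZeroSubsum
  where
  noProperZeroSubsum : NoProperZeroSubsum (twoValued b a a b)
  noProperZeroSubsum T τ 0<∣T∣ ∣T∣<∣S∣ z
    with i , T′ , i≤b , σ , refl ← ⊆-replicate-++ b (+ a) _ τ
    with j , refl ← ⊆-replicate σ
    with coprime-equalMultiples {j = j} cop 0<b i≤b
           (zeroSum-++⇒ (replicate i (+ a)) _ (sumℤ-replicate-pos i a) (sumℤ-replicate-neg j b) z)
  ... | inj₁ (refl , refl) = ℕP.<-irrefl refl 0<∣T∣
  ... | inj₂ (refl , refl) = ℕP.<-irrefl refl ∣T∣<∣S∣

twoValued-MZSOver : ∀ {m M a b} → Coprime a b → 0 < b → a ≤ M → b ≤ m →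
  IsMZSOver m M (twoValued b a a b)
twoValued-MZSOver {a = a} {b} cop 0<b a≤M b≤m =
  AllP.++⁺ (AllP.replicate⁺ b (ℤP.neg-≤-pos , ℤ.+≤+ a≤M))
           (AllP.replicate⁺ a (ℤP.neg-mono-≤ (ℤ.+≤+ b≤m) , ℤP.neg-≤-pos)) ,
  twoValued-minimal cop 0<b

MZSOver-exists : ∀ {m M t t′} → t′ ≤ t → t′ ≤ M → t ∸ t′ < m → Coprime (M ∸ t′) (m ∸ (t ∸ t′)) →
  Σ (List ℤ) λ S → IsMZSOver m M S × length S ≡ m + M ∸ t
MZSOver-exists {m} {M} {t} {t′} t′≤t t′≤M u<m coprime =
  twoValued b a a b ,
  twoValued-MZSOver coprime (ℕP.m<n⇒0<n∸m u<m) (ℕP.m∸n≤m M t′) (ℕP.m∸n≤m m (t ∸ t′)) ,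
  ≡.trans (length-twoValued b a a b) ([m∸[t∸t′]]+[M∸t′]≡m+M∸t t′≤t (ℕP.<⇒≤ u<m) t′≤M)
  where
  a = M ∸ t′
  b = m ∸ (t ∸ t′)

posCount negCount : List ℤ → ℕ
posCount xs = length (filter (0ℤ ℤ.<?_) xs)
negCount xs = length (filter (ℤ._<? 0ℤ) xs)

posCount-↭ : ∀ {O S} → O ↭ S → posCount O ≡ posCount S
posCount-↭ p = PermP.↭-length (PermP.filter-↭ (0ℤ ℤ.<?_) p)

negCount-↭ : ∀ {O S} → O ↭ S → negCount O ≡ negCount S
negCount-↭ p = PermP.↭-length (PermP.filter-↭ (ℤ._<? 0ℤ) p)

posCount-map-neg : ∀ S → posCount (map -_ S) ≡ negCount S
posCount-map-neg []       = refl
posCount-map-neg (x ∷ xs) with x ℤ.<? 0ℤ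
... | yes x<0 rewrite LP.filter-accept (0ℤ ℤ.<?_) { - x} {map -_ xs} (ℤP.neg-mono-< x<0) =
  cong suc (posCount-map-neg xs)
... | no  x≮0 rewrite LP.filter-reject (0ℤ ℤ.<?_) { - x} {map -_ xs} (x≮0 ∘ ℤP.neg-cancel-<) =
  posCount-map-neg xs

nonzero-↭-bySign : ∀ {S} → All (_≢ 0ℤ) S → S ↭ filter (0ℤ ℤ.<?_) S ++ filter (ℤ._<? 0ℤ) S
nonzero-↭-bySign [] = refl
nonzero-↭-bySign {x ∷ xs} (x≢0 ∷ xs≢0) with 0ℤ ℤ.<? x
... | yes 0<x rewrite LP.filter-reject (ℤ._<? 0ℤ) {x} {xs} (ℤP.<-asym 0<x) =
  prep x (nonzero-↭-bySign xs≢0)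
... | no  x≯0 rewrite LP.filter-accept (ℤ._<? 0ℤ) {x} {xs} (ℤP.≤∧≢⇒< (ℤP.≮⇒≥ x≯0) x≢0) =
  ↭-trans (prep x (nonzero-↭-bySign xs≢0)) (↭-sym (PermP.shift x (filter (0ℤ ℤ.<?_) xs) _))

length-bySign : ∀ {S} → All (_≢ 0ℤ) S → length S ≡ posCount S + negCount S
length-bySign {S} S≢0 =
  ≡.trans (PermP.↭-length (nonzero-↭-bySign S≢0)) (LP.length-++ (filter (0ℤ ℤ.<?_) S))

-- Greedy orderings

partialSums : ℤ → List ℤ → List ℤ
partialSums c []       = []
partialSums c (x ∷ xs) = c ∷ partialSums (c ℤ.+ x) xs

∈-partialSums : ∀ c xs {v} → v ∈ partialSums c xs →
  ∃ λ T → T ⊆ xs × length T < length xs × v ≡ c ℤ.+ sumℤ T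
∈-partialSums c (x ∷ xs) (here refl) = [] , minimum _ , s≤s z≤n , sym (ℤP.+-identityʳ c)
∈-partialSums c (x ∷ xs) (there v∈) with T , τ , ∣T∣<∣xs∣ , refl ← ∈-partialSums (c ℤ.+ x) xs v∈ =
  x ∷ T , refl ∷ τ , s≤s ∣T∣<∣xs∣ , ℤP.+-assoc c x (sumℤ T)

partialSums-distinct : ∀ c O → NoProperZeroSubsum O → AllPairs _≢_ (partialSums c O)
partialSums-distinct c []       _  = []
partialSums-distinct c (x ∷ xs) hO = All.tabulate c≢later ∷ partialSums-distinct (c ℤ.+ x) xs hxs
  where
  hxs : NoProperZeroSubsum xs
  hxs T τ 0<∣T∣ ∣T∣<∣xs∣ = hO T (x ∷ʳ τ) 0<∣T∣ (ℕP.m<n⇒m<1+n ∣T∣<∣xs∣)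
  c≢later : ∀ {v} → v ∈ partialSums (c ℤ.+ x) xs → c ≢ v
  c≢later v∈ c≡v with T , τ , ∣T∣<∣xs∣ , v≡ ← ∈-partialSums (c ℤ.+ x) xs v∈ =
    hO (x ∷ T) (refl ∷ τ) (s≤s z≤n) (s≤s ∣T∣<∣xs∣)
      (identityʳ-unique c _ (≡.trans (sym (ℤP.+-assoc c x _)) (sym (≡.trans c≡v v≡))))

GreedyStep : ℤ → ℤ → Set
GreedyStep c x = (c ℤ.< 0ℤ × 0ℤ ℤ.< x) ⊎ (0ℤ ℤ.≤ c × x ℤ.< 0ℤ)

data Greedy : ℤ → List ℤ → Set where
  []  : ∀ {c} → Greedy c []
  _∷_ : ∀ {c x xs} → GreedyStep c x → Greedy (c ℤ.+ x) xs → Greedy c (x ∷ xs)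

positive-term : ∀ xs → 0ℤ ℤ.< sumℤ xs → Any (0ℤ ℤ.<_) xs
positive-term []       (ℤ.+<+ ())
positive-term (x ∷ xs) 0<Σ with 0ℤ ℤ.<? x
... | yes 0<x = here 0<x
... | no  x≯0 = there (positive-term xs (subst (0ℤ ℤ.<_) (ℤP.+-identityˡ _)
                  (ℤP.<-≤-trans 0<Σ (ℤP.+-monoˡ-≤ (sumℤ xs) (ℤP.≮⇒≥ x≯0)))))

negative-term : ∀ x xs → All (_≢ 0ℤ) (x ∷ xs) → sumℤ (x ∷ xs) ℤ.≤ 0ℤ → Any (ℤ._< 0ℤ) (x ∷ xs)
negative-term x xs (x≢0 ∷ xs≢0) Σ≤0 with x ℤ.<? 0ℤ
... | yes x<0 = here x<0
negative-term x [] (x≢0 ∷ []) Σ≤0 | no x≮0 =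
  here (ℤP.≤∧≢⇒< (subst (ℤ._≤ 0ℤ) (ℤP.+-identityʳ x) Σ≤0) x≢0)
negative-term x (y ∷ ys) (x≢0 ∷ xs≢0) Σ≤0 | no x≮0 = there (negative-term y ys xs≢0
  (subst (ℤ._≤ 0ℤ) (ℤP.+-identityˡ _) (ℤP.≤-trans (ℤP.+-monoˡ-≤ (sumℤ (y ∷ ys)) (ℤP.≮⇒≥ x≮0)) Σ≤0)))

greedyStep-exists : ∀ c r rs → All (_≢ 0ℤ) (r ∷ rs) → c ℤ.+ sumℤ (r ∷ rs) ≡ 0ℤ →
  ∃ λ x → x ∈ r ∷ rs × GreedyStep c x
greedyStep-exists c r rs R≢0 c+ΣR≡0 with c ℤ.<? 0ℤ
... | yes c<0 =
  let x , x∈R , 0<x = find (positive-term (r ∷ rs) 0<ΣR) in x , x∈R , inj₁ (c<0 , 0<x)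
  where
  0<ΣR : 0ℤ ℤ.< sumℤ (r ∷ rs)
  0<ΣR = ℤP.≤-<-trans (ℤP.≤-reflexive (sym c+ΣR≡0))
           (subst (c ℤ.+ sumℤ (r ∷ rs) ℤ.<_) (ℤP.+-identityˡ _) (ℤP.+-monoˡ-< (sumℤ (r ∷ rs)) c<0))
... | no c≮0 =
  let x , x∈R , x<0 = find (negative-term r rs R≢0 ΣR≤0) in x , x∈R , inj₂ (ℤP.≮⇒≥ c≮0 , x<0)
  where
  ΣR≤0 : sumℤ (r ∷ rs) ℤ.≤ 0ℤ
  ΣR≤0 = ℤP.≤-trans (subst (ℤ._≤ c ℤ.+ sumℤ (r ∷ rs)) (ℤP.+-identityˡ _)
           (ℤP.+-monoˡ-≤ (sumℤ (r ∷ rs)) (ℤP.≮⇒≥ c≮0))) (ℤP.≤-reflexive c+ΣR≡0)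

greedy-exists : ∀ n c R → length R ≡ n → All (_≢ 0ℤ) R → c ℤ.+ sumℤ R ≡ 0ℤ →
  ∃ λ O → O ↭ R × Greedy c O
greedy-exists _       c []         _    _   _ = [] , refl , []
greedy-exists (suc n) c R@(r ∷ rs) ∣R∣ R≢0 c+ΣR≡0
  with x , x∈R , step ← greedyStep-exists c r rs R≢0 c+ΣR≡0
  with R′ , R↭ ← ∈⇒↭∷ x∈R
  with O′ , O′↭R′ , g ← greedy-exists n (c ℤ.+ x) R′
         (ℕP.suc-injective (≡.trans (sym (PermP.↭-length R↭)) ∣R∣))
         (All.tail (PermP.All-resp-↭ R↭ R≢0))
         (≡.trans (ℤP.+-assoc c x _) (≡.trans (cong (λ w → c ℤ.+ w) (sym (sumℤ-↭ R↭))) c+ΣR≡0))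
  = x ∷ O′ , ↭-trans (prep x O′↭R′) (↭-sym R↭) , step ∷ g

greedy-negativeSums : ∀ {c O} → Greedy c O →
  length (filter (ℤ._<? 0ℤ) (partialSums c O)) ≡ posCount O
greedy-negativeSums [] = refl
greedy-negativeSums {c} {x ∷ xs} (inj₁ (c<0 , 0<x) ∷ g)
  rewrite LP.filter-accept (ℤ._<? 0ℤ) {c} {partialSums (c ℤ.+ x) xs} c<0
        | LP.filter-accept (0ℤ ℤ.<?_) {x} {xs} 0<x = cong suc (greedy-negativeSums g)
greedy-negativeSums {c} {x ∷ xs} (inj₂ (0≤c , x<0) ∷ g)
  rewrite LP.filter-reject (ℤ._<? 0ℤ) {c} {partialSums (c ℤ.+ x) xs} (ℤP.≤⇒≯ 0≤c)
        | LP.filter-reject (0ℤ ℤ.<?_) {x} {xs} (ℤP.<-asym x<0) = greedy-negativeSums g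

greedy-nonnegativeSums : ∀ {c O} → Greedy c O →
  length (filter (0ℤ ℤ.≤?_) (partialSums c O)) ≡ negCount O
greedy-nonnegativeSums [] = refl
greedy-nonnegativeSums {c} {x ∷ xs} (inj₁ (c<0 , 0<x) ∷ g)
  rewrite LP.filter-reject (0ℤ ℤ.≤?_) {c} {partialSums (c ℤ.+ x) xs} (ℤP.<⇒≱ c<0)
        | LP.filter-reject (ℤ._<? 0ℤ) {x} {xs} (ℤP.<-asym 0<x) = greedy-nonnegativeSums g
greedy-nonnegativeSums {c} {x ∷ xs} (inj₂ (0≤c , x<0) ∷ g)
  rewrite LP.filter-accept (0ℤ ℤ.≤?_) {c} {partialSums (c ℤ.+ x) xs} 0≤c
        | LP.filter-accept (ℤ._<? 0ℤ) {x} {xs} x<0 = cong suc (greedy-nonnegativeSums g)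

partialSums-< : ∀ {b c O} → Greedy c O → All (ℤ._≤ + b) O → c ℤ.< + b →
  All (ℤ._< + b) (partialSums c O)
partialSums-< [] [] _ = []
partialSums-< {c = c} {x ∷ _} (inj₁ (c<0 , _) ∷ g) (x≤b ∷ xs≤b) c<b =
  c<b ∷ partialSums-< g xs≤b (subst (c ℤ.+ x ℤ.<_) (ℤP.+-identityˡ _) (ℤP.+-mono-<-≤ c<0 x≤b))
partialSums-< {c = c} (inj₂ (_ , x<0) ∷ g) (_ ∷ xs≤b) c<b =
  c<b ∷ partialSums-< g xs≤b
    (ℤP.<-trans (subst (c ℤ.+ _ ℤ.<_) (ℤP.+-identityʳ c) (ℤP.+-monoʳ-< c x<0)) c<b)

partialSums-≥ : ∀ {a c O} → Greedy c O → All (- + a ℤ.≤_) O → - + a ℤ.≤ c →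
  All (- + a ℤ.≤_) (partialSums c O)
partialSums-≥ [] [] _ = []
partialSums-≥ {c = c} (inj₁ (_ , 0<x) ∷ g) (_ ∷ xs≥) c≥ =
  c≥ ∷ partialSums-≥ g xs≥ (ℤP.≤-trans c≥ (ℤP.i≤i+j c _ {{ℤ.nonNegative (ℤP.<⇒≤ 0<x)}}))
partialSums-≥ (inj₂ (0≤c , _) ∷ g) (x≥ ∷ xs≥) c≥ =
  c≥ ∷ partialSums-≥ g xs≥ (subst (ℤ._≤ _) (ℤP.+-identityˡ _) (ℤP.+-mono-≤ 0≤c x≥))

partialSums-≥-nonzero : ∀ {a c O} → Greedy c O → All (- + suc a ℤ.≤_) O → - + a ℤ.≤ c →
  All (_≢ 0ℤ) (partialSums c O) → All (- + a ℤ.≤_) (partialSums c O)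
partialSums-≥-nonzero [] [] _ _ = []
partialSums-≥-nonzero {c = c} (inj₁ (_ , 0<x) ∷ g) (_ ∷ xs≥) c≥ (_ ∷ ≢0) =
  c≥ ∷ partialSums-≥-nonzero g xs≥ (ℤP.≤-trans c≥ (ℤP.i≤i+j c _ {{ℤ.nonNegative (ℤP.<⇒≤ 0<x)}}))
    ≢0
partialSums-≥-nonzero (inj₂ (0≤c , _) ∷ g) (x≥ ∷ xs≥) c≥ (c≢0 ∷ ≢0) =
  c≥ ∷ partialSums-≥-nonzero g xs≥ (subst (ℤ._≤ _) (ℤP.1-[1+n]≡-n _)
    (ℤP.+-mono-≤ (ℤP.i<j⇒suc[i]≤j (ℤP.≤∧≢⇒< 0≤c (c≢0 ∘ sym))) x≥)) ≢0

interval : ℤ → ℕ → List ℤ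
interval lo zero    = []
interval lo (suc k) = lo ∷ interval (ℤ.suc lo) k

length-interval : ∀ lo k → length (interval lo k) ≡ k
length-interval lo zero    = refl
length-interval lo (suc k) = cong suc (length-interval (ℤ.suc lo) k)

∈-interval : ∀ k lo {v} → lo ℤ.≤ v → v ℤ.< lo ℤ.+ + k → v ∈ interval lo k
∈-interval zero    lo lo≤v v<lo = ⊥-elim (ℤP.<⇒≱ (subst (_ ℤ.<_) (ℤP.+-identityʳ lo) v<lo) lo≤v)
∈-interval (suc k) lo {v} lo≤v v< with lo ℤ.≟ v
... | yes refl = here refl
... | no lo≢v  = there (∈-interval k (ℤ.suc lo) (ℤP.i<j⇒suc[i]≤j (ℤP.≤∧≢⇒< lo≤v lo≢v))
                  (subst (v ℤ.<_) (shift lo) v<))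
  where
  shift : ∀ lo → lo ℤ.+ + suc k ≡ ℤ.suc lo ℤ.+ + k
  shift lo = ≡.trans (cong (λ w → lo ℤ.+ w) (ℤP.pos-+ 1 k))
    (≡.trans (sym (ℤP.+-assoc lo (+ 1) (+ k))) (cong (ℤ._+ + k) (ℤP.+-comm lo (+ 1))))

distinct-inRange-length≤ : ∀ {lo k xs} → AllPairs _≢_ xs →
  All (λ v → lo ℤ.≤ v × v ℤ.< lo ℤ.+ + k) xs → length xs ≤ k
distinct-inRange-length≤ {lo} {k} xs! inRange = subst (_ ≤_) (length-interval lo k)
  (distinct-⊆-length≤ xs! λ v∈xs → let lo≤v , v< = All.lookup inRange v∈xs in ∈-interval k lo lo≤v v<)

distinct-negatives≤ : ∀ {a xs} → AllPairs _≢_ xs → All (- + a ℤ.≤_) xs →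
  length (filter (ℤ._<? 0ℤ) xs) ≤ a
distinct-negatives≤ {a} {xs} xs! a≤xs = distinct-inRange-length≤ (AllPairsP.filter⁺ (ℤ._<? 0ℤ) xs!)
  (All.zipWith (λ {v} (a≤v , v<0) → a≤v , subst (v ℤ.<_) (sym (ℤP.+-inverseˡ (+ a))) v<0)
    (AllP.filter⁺ (ℤ._<? 0ℤ) a≤xs , AllP.all-filter (ℤ._<? 0ℤ) xs))

distinct-nonnegatives≤ : ∀ {b xs} → AllPairs _≢_ xs → All (ℤ._< + b) xs →
  length (filter (0ℤ ℤ.≤?_) xs) ≤ b
distinct-nonnegatives≤ {b} {xs} xs! xs<b = distinct-inRange-length≤ (AllPairsP.filter⁺ (0ℤ ℤ.≤?_) xs!)
  (All.zipWith (λ {v} (v<b , 0≤v) → 0≤v , subst (v ℤ.<_) (sym (ℤP.+-identityˡ (+ b))) v<b)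
    (AllP.filter⁺ (0ℤ ℤ.≤?_) xs<b , AllP.all-filter (0ℤ ℤ.≤?_) xs))

signCounts-bounded : ∀ {a b S} → NoProperZeroSubsum S → All (_≢ 0ℤ) S → IsZeroSum S →
  All (InInterval (- + a) (+ b)) S → 0 < b → posCount S ≤ a × negCount S ≤ b
signCounts-bounded {a} {b} {S} hS S≢0 ΣS≡0 S∈[-a,b] 0<b
  with O , O↭S , g ← greedy-exists _ 0ℤ S refl S≢0 (≡.trans (ℤP.+-identityˡ _) ΣS≡0) =
  subst (_≤ a) (≡.trans (greedy-negativeSums g) (posCount-↭ O↭S))
    (distinct-negatives≤ sums! (partialSums-≥ g (All.map proj₁ O∈[-a,b]) (ℤP.neg-≤-pos {a} {0}))) ,
  subst (_≤ b) (≡.trans (greedy-nonnegativeSums g) (negCount-↭ O↭S))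
    (distinct-nonnegatives≤ sums! (partialSums-< g (All.map proj₂ O∈[-a,b]) (ℤ.+<+ 0<b)))
  where
  O∈[-a,b] = PermP.All-resp-↭ (↭-sym O↭S) S∈[-a,b]
  sums! = partialSums-distinct 0ℤ O (NoProperZeroSubsum-↭ hS (↭-sym O↭S))

posCount≡⇒negatives≡ : ∀ {a b S} → NoProperZeroSubsum S → All (_≢ 0ℤ) S → IsZeroSum S →
  All (InInterval (- + a) (+ b)) S → posCount S ≡ a → ∀ {x} → x ∈ S → x ℤ.< 0ℤ → x ≡ - + a
posCount≡⇒negatives≡ {zero} _ _ _ S∈[-a,b] _ x∈S x<0 =
  ⊥-elim (ℤP.≤⇒≯ (proj₁ (All.lookup S∈[-a,b] x∈S)) x<0)
posCount≡⇒negatives≡ {suc a} {S = S} hS S≢0 ΣS≡0 S∈[-a,b] posCount≡ {x} x∈S x<0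
  with x ℤ.≟ - + suc a
... | yes x≡ = x≡
... | no  x≢ with R , S↭ ← ∈⇒↭∷ x∈S
  with O′ , O′↭R , g ← greedy-exists _ (0ℤ ℤ.+ x) R refl (All.tail (PermP.All-resp-↭ S↭ S≢0))
         (≡.trans (cong (ℤ._+ sumℤ R) (ℤP.+-identityˡ x)) (≡.trans (sym (sumℤ-↭ S↭)) ΣS≡0))
  = ⊥-elim (ℕP.<-irrefl refl (subst (_≤ a) negativeSums≡ (distinct-negatives≤ later! laterSums≥)))
  where
  O↭S : x ∷ O′ ↭ S
  O↭S = ↭-trans (prep x O′↭R) (↭-sym S↭)
  O∈[-a,b] = PermP.All-resp-↭ (↭-sym O↭S) S∈[-a,b]
  -a≤x : - + a ℤ.≤ 0ℤ ℤ.+ x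
  -a≤x = subst₂ ℤ._≤_ (ℤP.1-[1+n]≡-n a) (sym (ℤP.+-identityˡ x))
           (ℤP.i<j⇒suc[i]≤j (ℤP.≤∧≢⇒< (proj₁ (All.head O∈[-a,b])) (x≢ ∘ sym)))
  sums! = partialSums-distinct 0ℤ (x ∷ O′) (NoProperZeroSubsum-↭ hS (↭-sym O↭S))
  later! = AllPairs.tail sums!
  laterSums≥ : All (- + a ℤ.≤_) (partialSums (0ℤ ℤ.+ x) O′)
  laterSums≥ = partialSums-≥-nonzero g (All.map proj₁ (All.tail O∈[-a,b])) -a≤x
                 (All.map (_∘ sym) (AllPairs.head sums!))
  negativeSums≡ : length (filter (ℤ._<? 0ℤ) (partialSums (0ℤ ℤ.+ x) O′)) ≡ suc a
  negativeSums≡ = begin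
    length (filter (ℤ._<? 0ℤ) (partialSums (0ℤ ℤ.+ x) O′)) ≡⟨ greedy-negativeSums g ⟩
    posCount O′       ≡⟨ cong length (LP.filter-reject (0ℤ ℤ.<?_) (ℤP.<-asym x<0)) ⟨
    posCount (x ∷ O′) ≡⟨ posCount-↭ O↭S ⟩
    posCount S        ≡⟨ posCount≡ ⟩
    suc a             ∎
    where open ≡.≡-Reasoning

long⇒posCount≡⊎negCount≡ : ∀ {m M S} → 0 < M → NoProperZeroSubsum S → All (_≢ 0ℤ) S →
  IsZeroSum S → All (InInterval (- + m) (+ M)) S → m + M ≤ suc (length S) →
  posCount S ≡ m ⊎ negCount S ≡ M
long⇒posCount≡⊎negCount≡ {m} {M} {S} 0<M hS S≢0 ΣS≡0 S∈ long with posCount S ℕP.≟ m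
... | yes posCount≡m = inj₁ posCount≡m
... | no  posCount≢m = inj₂ (ℕP.≤-antisym negCount≤M (ℕP.+-cancelˡ-≤ m _ _ (begin
  m + M                             ≤⟨ long ⟩
  suc (length S)                    ≡⟨ cong suc (length-bySign S≢0) ⟩
  suc (posCount S) + negCount S     ≤⟨ ℕP.+-monoˡ-≤ (negCount S) (ℕP.≤∧≢⇒< posCount≤m posCount≢m) ⟩
  m + negCount S                    ∎)))
  where
  open ℕP.≤-Reasoning
  posCount≤m = proj₁ (signCounts-bounded hS S≢0 ΣS≡0 S∈ 0<M)
  negCount≤M = proj₂ (signCounts-bounded hS S≢0 ΣS≡0 S∈ 0<M)

-- Sequences of length m without short zero sums modulo m

NoShortZeroSumMod : ℕ → List ℕ → Set
NoShortZeroSumMod m P = ∀ T → T ⊆ P → 0 < length T → length T < m → ¬ (m ∣ sum T)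

NoShortZeroSumMod-↭ : ∀ {m P Q} → NoShortZeroSumMod m P → P ↭ Q → NoShortZeroSumMod m Q
NoShortZeroSumMod-↭ hP P↭Q T τ 0<∣T∣ ∣T∣<m m∣ΣT with T′ , σ , π ← ⊆-↭-exchange τ (↭-sym P↭Q) =
  hP T′ σ (subst (0 <_) (sym ∣π∣) 0<∣T∣) (subst (_< _) (sym ∣π∣) ∣T∣<m)
    (subst (_ ∣_) (sym (sum-↭ π)) m∣ΣT)
  where ∣π∣ = PermP.↭-length π

module _ {n x} {A : List ℕ} (∣A∣≡n : length A ≡ n) (noZeroSum : NoShortZeroSumMod (suc n) (x ∷ A)) where

  private
    m = suc n

    T : ℕ → ℕ
    T i = sum (take i A)

    segment : ∀ {i j} → i ≤ j → j ≤ n → ∃ λ s → s ⊆ A × length s ≡ j ∸ i × T j ≡ T i + sum s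
    segment i≤j j≤n = take-segment A i≤j (subst (_ ≤_) (sym ∣A∣≡n) j≤n)

    prefixResidues-distinct : ∀ c {i j} → i < j → j < m → (c + T i) % m ≢ (c + T j) % m
    prefixResidues-distinct c {i} {j} i<j (s≤s j≤n) eq
      with s , τ , ∣s∣ , Tj≡ ← segment (ℕP.<⇒≤ i<j) j≤n =
      noZeroSum s (x ∷ʳ τ) (subst (0 <_) (sym ∣s∣) (ℕP.m<n⇒0<n∸m i<j))
        (subst (_< m) (sym ∣s∣) (s≤s (ℕP.≤-trans (ℕP.m∸n≤m j i) j≤n)))
        (%-cancelˡ-+ (c + T i) (sum s) m
          (≡.trans (cong (_% m) (≡.trans (ℕP.+-assoc c (T i) (sum s)) (cong (λ t → c + t) (sym Tj≡))))
                   (sym eq)))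

    prefixResidues-onto : ∀ c {r} → r < m → ∃ λ j → j ≤ n × (c + T j) % m ≡ r
    prefixResidues-onto c r<m
      with j , j<m , eq ← injective⇒surjective m (λ i → (c + T i) % m) (prefixResidues-distinct c)
                            (λ i → m%n<n (c + T i) m) r<m
      = j , ℕP.≤-pred j<m , eq

    x+prefix≢earlierPrefix : ∀ {i j} → 0 < i → i ≤ j → j ≤ n → (x + T j) % m ≢ T i % m
    x+prefix≢earlierPrefix {suc i} {suc j} _ (s≤s i≤j) j<n eq
      with s , τ , ∣s∣ , Tj≡ ← segment (s≤s i≤j) j<n =
      noZeroSum (x ∷ s) (refl ∷ τ) (s≤s z≤n)
        (s≤s (subst (_< n) (sym ∣s∣) (ℕP.<-≤-trans (s≤s (ℕP.m∸n≤m j i)) j<n)))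
        (%-cancelˡ-+ (T (suc i)) (x + sum s) m (≡.trans (cong (_% m)
          (≡.trans (x∙yz≈y∙xz (T (suc i)) x (sum s)) (cong (λ t → x + t) (sym Tj≡)))) eq))

    commonDivisor∣prefixSums : ∀ {d} → d ∣ x → d ∣ m → ∀ i → i ≤ n → d ∣ T i
    commonDivisor∣prefixSums {d} d∣x d∣m = <-rec (λ i → i ≤ n → d ∣ T i) step
      where
      step : ∀ i → (∀ {j} → j < i → j ≤ n → d ∣ T j) → i ≤ n → d ∣ T i
      step zero      _   _   = d ∣0
      step i@(suc _) rec i≤n
        with j , j≤n , eq ← prefixResidues-onto x (m%n<n (T i) m)
        with i ℕP.≤? j
      ... | yes i≤j = ⊥-elim (x+prefix≢earlierPrefix (s≤s z≤n) i≤j j≤n eq)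
      ... | no  i≰j = ∣n∣m%n⇒∣m d∣m
        (subst (d ∣_) eq (%-presˡ-∣ (∣m∣n⇒∣m+n d∣x (rec (ℕP.≰⇒> i≰j) j≤n)) d∣m))

  noShortZeroSumMod⇒coprime : Coprime x (suc n)
  noShortZeroSumMod⇒coprime {d} (d∣x , d∣m)
    with j , j≤n , Tj%m≡1%m ← prefixResidues-onto 0 (m%n<n 1 m) =
    ∣1⇒≡1 (∣n∣m%n⇒∣m d∣m
      (subst (d ∣_) Tj%m≡1%m (%-presˡ-∣ (commonDivisor∣prefixSums d∣x d∣m j j≤n) d∣m)))

posAndNeg : List ℕ → ℕ → ℕ → List ℤ
posAndNeg P q a = map +_ P ++ replicate q (- + a)

length-posAndNeg : ∀ P q a → length (posAndNeg P q a) ≡ length P + q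
length-posAndNeg P q a =
  ≡.trans (LP.length-++ (map +_ P)) (cong₂ _+_ (LP.length-map +_ P) (LP.length-replicate q))

module _ {a q} (P : List ℕ) (hP : NoProperZeroSubsum (posAndNeg P q a))
         (ΣP≡0 : IsZeroSum (posAndNeg P q a)) (∣P∣≡a : length P ≡ a) where

  positives-noShortZeroSumMod : NoShortZeroSumMod a P
  positives-noShortZeroSumMod T T⊆P 0<∣T∣ ∣T∣<a (divides j ΣT≡j*a) =
    hP (posAndNeg T j a) (SublistP.++⁺ (SublistP.map⁺ +_ T⊆P) (replicate-⊆ (- + a) j≤q))
       (subst (0 <_) (sym (length-posAndNeg T j a)) (ℕP.<-≤-trans 0<∣T∣ (ℕP.m≤m+n _ j)))
       (subst₂ _<_ (sym (length-posAndNeg T j a))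
         (≡.trans (cong (_+ q) (sym ∣P∣≡a)) (sym (length-posAndNeg P q a))) (ℕP.+-mono-<-≤ ∣T∣<a j≤q))
       (≡.trans (sumℤ-++ (map +_ T) _) (≡.trans (cong₂ ℤ._+_ (sumℤ-map-+ T) (sumℤ-replicate-neg j a))
         (≡.trans (cong (λ w → + w ℤ.- + (j * a)) ΣT≡j*a) (ℤP.+-inverseʳ (+ (j * a))))))
    where
    j≤q : j ≤ q
    j≤q = ℕP.*-cancelʳ-≤ j q a {{ℕ.>-nonZero (ℕP.≤-<-trans z≤n ∣T∣<a)}}
      (subst₂ _≤_ ΣT≡j*a (zeroSum-++⇒ (map +_ P) _ (sumℤ-map-+ P) (sumℤ-replicate-neg q a) ΣP≡0)
        (sum-⊆ T⊆P))

  positives-coprime : ∀ {y} → y ∈ P → Coprime y a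
  positives-coprime {y} y∈P with A , P↭ ← ∈⇒↭∷ y∈P = subst (Coprime y) ∣P∣≡
    (noShortZeroSumMod⇒coprime refl
      (subst (λ k → NoShortZeroSumMod k (y ∷ A)) (sym ∣P∣≡)
        (NoShortZeroSumMod-↭ positives-noShortZeroSumMod P↭)))
    where
    ∣P∣≡ : suc (length A) ≡ a
    ∣P∣≡ = ≡.trans (sym (PermP.↭-length P↭)) ∣P∣≡a

positiveParts : List ℤ → List ℕ
positiveParts S = map ℤ.∣_∣ (filter (0ℤ ℤ.<?_) S)

map-+-positiveParts : ∀ S → map +_ (positiveParts S) ≡ filter (0ℤ ℤ.<?_) S
map-+-positiveParts S = ≡.trans (sym (LP.map-∘ (filter (0ℤ ℤ.<?_) S)))
  (LP.map-id-local (All.map (ℤP.0≤i⇒+∣i∣≡i ∘ ℤP.<⇒≤) (AllP.all-filter (0ℤ ℤ.<?_) S)))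

↭-posAndNeg : ∀ {a S} → All (_≢ 0ℤ) S → (∀ {x} → x ∈ S → x ℤ.< 0ℤ → x ≡ - + a) →
  S ↭ posAndNeg (positiveParts S) (negCount S) a
↭-posAndNeg {S = S} S≢0 negatives≡ = subst₂ (λ P N → S ↭ P ++ N) (sym (map-+-positiveParts S))
  (all≡⇒replicate _ (All.tabulate λ x∈ →
    let x∈S , x<0 = MP.∈-filter⁻ (ℤ._<? 0ℤ) x∈ in negatives≡ x∈S x<0))
  (nonzero-↭-bySign S≢0)

-- The upper bound

posCount≢ : ∀ {a b S} → 0 < a → 2 ≤ b → ¬ Coprime b a → ¬ Coprime (b ∸ 1) a →
  IsMZSOver a b S → a + b ≤ suc (length S) → posCount S ≢ a
posCount≢ {a} {b@(suc (suc b′))} {S} 0<a (s≤s (s≤s _)) b∤a b-1∤a (S∈[-a,b] , mz@(_ , ΣS≡0 , hS))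
  long posCount≡a =
  ℕP.<-irrefl refl (begin-strict
    suc b′ * a            ≤⟨ ℕP.*-monoˡ-≤ a b-1≤q ⟩
    q * a                 ≡⟨ ΣP≡q*a ⟨
    sum P                 ≤⟨ sum≤length* P P≤b-2 ⟩
    length P * b′         ≡⟨ cong (_* b′) ∣P∣≡a ⟩
    a * b′                ≡⟨ ℕP.*-comm a b′ ⟩
    b′ * a                <⟨ ℕP.m<n+m (b′ * a) 0<a ⟩
    suc b′ * a            ∎)
  where
  open ℕP.≤-Reasoning
  S≢0 = minimal⇒nonzero mz (ℕP.≤-pred (ℕP.≤-trans (ℕP.+-mono-≤ 0<a (s≤s (s≤s z≤n))) long))
  P = positiveParts S
  q = negCount S
  S↭ : S ↭ posAndNeg P q a
  S↭ = ↭-posAndNeg S≢0 (posCount≡⇒negatives≡ hS S≢0 ΣS≡0 S∈[-a,b] posCount≡a)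
  ∣P∣≡a : length P ≡ a
  ∣P∣≡a = ≡.trans (LP.length-map ℤ.∣_∣ (filter (0ℤ ℤ.<?_) S)) posCount≡a
  ΣP≡0 : IsZeroSum (posAndNeg P q a)
  ΣP≡0 = ≡.trans (sym (sumℤ-↭ S↭)) ΣS≡0
  ΣP≡q*a : sum P ≡ q * a
  ΣP≡q*a = zeroSum-++⇒ (map +_ P) _ (sumℤ-map-+ P) (sumℤ-replicate-neg q a) ΣP≡0
  b-1≤q : suc b′ ≤ q
  b-1≤q = ℕP.≤-pred (ℕP.+-cancelˡ-≤ a _ _ (ℕP.≤-trans long (ℕP.≤-reflexive (begin-equality
    suc (length S)                 ≡⟨ cong suc (PermP.↭-length S↭) ⟩
    suc (length (posAndNeg P q a)) ≡⟨ cong suc (length-posAndNeg P q a) ⟩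
    suc (length P + q)             ≡⟨ cong (λ k → suc (k + q)) ∣P∣≡a ⟩
    suc (a + q)                    ≡⟨ ℕP.+-suc a q ⟨
    a + suc q                      ∎))))
  P≤b : All (_≤ b) P
  P≤b = All.map ℤP.drop‿+≤+ (AllP.map⁻ (subst (All (ℤ._≤ + b)) (sym (map-+-positiveParts S))
          (AllP.filter⁺ (0ℤ ℤ.<?_) (All.map proj₂ S∈[-a,b]))))
  P≤b-2 : All (_≤ b′) P
  P≤b-2 = All.tabulate λ {y} y∈P →
    let y-coprime = positives-coprime P (NoProperZeroSubsum-↭ hS S↭) ΣP≡0 ∣P∣≡a y∈P
        y≢b   = λ y≡b → b∤a (subst (λ k → Coprime k a) y≡b y-coprime)
        y≢b-1 = λ y≡b-1 → b-1∤a (subst (λ k → Coprime k a) y≡b-1 y-coprime)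
    in ℕP.≤-pred (ℕP.≤∧≢⇒< (ℕP.≤-pred (ℕP.≤∧≢⇒< (All.lookup P≤b y∈P) y≢b)) y≢b-1)

MZSOver-length≤ : ∀ {m M S} → 0 < m → 0 < M →
  ¬ Coprime M m → ¬ Coprime (M ∸ 1) m → ¬ Coprime M (m ∸ 1) →
  IsMZSOver m M S → length S ≤ m + M ∸ 2
MZSOver-length≤ {m} {M} {S} 0<m 0<M M∤m M-1∤m M∤m-1 mzs@(S∈ , mz@(_ , ΣS≡0 , hS))
  with length S ℕP.≤? m + M ∸ 2
... | yes short = short
... | no  ¬short =
  ⊥-elim ([ fullPositives , fullNegatives ]′ (long⇒posCount≡⊎negCount≡ 0<M hS S≢0 ΣS≡0 S∈ long))
  where
  2≤m = ℕP.<⇒≤ (¬coprime⇒3≤ 0<m M∤m M∤m-1)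
  2≤M = ℕP.<⇒≤ (¬coprime⇒3≤ 0<M (M∤m ∘ Coprimality.sym) (M-1∤m ∘ Coprimality.sym))
  long : m + M ≤ suc (length S)
  long = subst (_≤ suc (length S)) (ℕP.m+[n∸m]≡n (ℕP.≤-trans 2≤m (ℕP.m≤m+n m M)))
           (s≤s (ℕP.≰⇒> ¬short))
  S≢0 = minimal⇒nonzero mz (ℕP.≤-pred (ℕP.≤-trans (ℕP.+-mono-≤ 2≤m 0<M) long))
  fullPositives : posCount S ≢ m
  fullPositives = posCount≢ 0<m 2≤M M∤m M-1∤m mzs long
  fullNegatives : negCount S ≢ M
  fullNegatives negCount≡M = posCount≢ 0<M 2≤m (M∤m ∘ Coprimality.sym) (M∤m-1 ∘ Coprimality.sym)
    (MZSOver-map-neg mzs) (subst₂ _≤_ (ℕP.+-comm m M) (cong suc (sym (LP.length-map -_ S))) long)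
    (≡.trans (posCount-map-neg S) negCount≡M)

-- The invariant ρ

[+m]-[+n]≡+[m∸n] : ∀ {a b} → b ≤ a → + a ℤ.- + b ≡ + (a ∸ b)
[+m]-[+n]≡+[m∸n] {a} {b} b≤a = ≡.trans (ℤP.[+m]-[+n]≡m⊖n a b) (ℤP.⊖-≥ b≤a)

rhoCond-gcd : ∀ {m M t t′} → t′ ≤ t → t′ ≤ M → t ∸ t′ ≤ m →
  ℤGCD.gcd (+ M ℤ.- + t′) (+ m ℤ.- (+ t ℤ.- + t′)) ≡ + ℕGCD.gcd (M ∸ t′) (m ∸ (t ∸ t′))
rhoCond-gcd t′≤t t′≤M u≤m
  rewrite [+m]-[+n]≡+[m∸n] t′≤t | [+m]-[+n]≡+[m∸n] u≤m | [+m]-[+n]≡+[m∸n] t′≤M = refl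

coprime⇒rhoCond : ∀ {m M t} t′ → t′ ≤ t → t′ ≤ M → t ∸ t′ ≤ m →
  Coprime (M ∸ t′) (m ∸ (t ∸ t′)) → RhoCond m M t
coprime⇒rhoCond t′ t′≤t t′≤M u≤m coprime =
  t′ , t′≤t , ≡.trans (rhoCond-gcd t′≤t t′≤M u≤m) (cong +_ (Coprimality.coprime⇒gcd≡1 coprime))

rhoCond⇒coprime : ∀ {m M t} → t ≤ M → t ≤ m → RhoCond m M t →
  ∃ λ t′ → t′ ≤ t × Coprime (M ∸ t′) (m ∸ (t ∸ t′))
rhoCond⇒coprime {t = t} t≤M t≤m (t′ , t′≤t , gcd≡1) = t′ , t′≤t ,
  Coprimality.gcd≡1⇒coprime (ℤP.+-injective (≡.trans (sym (rhoCond-gcd t′≤t t′≤M u≤m)) gcd≡1))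
  where
  t′≤M = ℕP.≤-trans t′≤t t≤M
  u≤m  = ℕP.≤-trans (ℕP.m∸n≤m t t′) t≤m

proposition3p10 : (m M : ℕ) → 0 < m → 0 < M → RhoIs m M 2 →
    DIntervalIs m M (m + M ∸ 2)
proposition3p10 m M 0<m 0<M (ρ≤2 , ρ≮2) =
  lowerBound , λ S → MZSOver-length≤ 0<m 0<M M∤m M-1∤m M∤m-1
  where
  M∤m : ¬ Coprime M m
  M∤m = ρ≮2 0 (s≤s z≤n) ∘ coprime⇒rhoCond 0 z≤n z≤n z≤n
  M-1∤m : ¬ Coprime (M ∸ 1) m
  M-1∤m = ρ≮2 1 (s≤s (s≤s z≤n)) ∘ coprime⇒rhoCond 1 ℕP.≤-refl 0<M z≤n
  M∤m-1 : ¬ Coprime M (m ∸ 1)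
  M∤m-1 = ρ≮2 1 (s≤s (s≤s z≤n)) ∘ coprime⇒rhoCond 0 z≤n z≤n 0<m
  3≤m : 3 ≤ m
  3≤m = ¬coprime⇒3≤ 0<m M∤m M∤m-1
  3≤M : 3 ≤ M
  3≤M = ¬coprime⇒3≤ 0<M (M∤m ∘ Coprimality.sym) (M-1∤m ∘ Coprimality.sym)
  lowerBound : Σ (List ℤ) λ S → IsMZSOver m M S × length S ≡ m + M ∸ 2
  lowerBound with t′ , t′≤2 , coprime ← rhoCond⇒coprime (ℕP.<⇒≤ 3≤M) (ℕP.<⇒≤ 3≤m) ρ≤2 =
    MZSOver-exists t′≤2 (ℕP.≤-trans t′≤2 (ℕP.<⇒≤ 3≤M)) (ℕP.≤-<-trans (ℕP.m∸n≤m 2 t′) 3≤m) coprime
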